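{- Let $m_1,m_2$ be integers with $1 \leq m_1 \leq m_2$ and let $G = K_{1,m_1}+K_{1,m_2}$. If $m_2 - m_1 \geq 2$, then $G$ is not equitably 2-choosable.
   Context: A list assignment $L$ for a graph $G$ assigns to each vertex $v$ a set $L(v)$ of colors; it is a $k$-assignment if $|L(v)|=k$ for all $v$. The palette of $L$ is $\bigcup_{v} L(v)$. A proper $L$-coloring is a proper coloring $f$ with $f(v)\in L(v)$ for all $v$. If $L$ is a $k$-assignment, an equitable $L$-coloring of $G$ is a proper $L$-coloring in which each color of the palette appears on at most $\lceil |V(G)|/k \rceil$ vertices. $G$ is equitably $k$-choosable if an equitable $L$-coloring exists for every $k$-assignment $L$ for $G$. -}

module Defs where

open import Data.Nat using (ℕ; zero; suc; _+_; _∸_; _≤_; NonZero)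
open import Data.Nat.DivMod using (_/_)
open import Data.Fin using (Fin; zero; suc; splitAt)
open import Data.Fin.Properties using () renaming (_≟_ to _≟F_)
open import Data.Nat.Properties using (_≟_)
open import Data.List using (List; length; filter)
open import Data.List.Base using ()
open import Data.Vec using (Vec)
open import Data.Vec.Membership.Propositional using (_∈_)
open import Data.Vec.Relation.Unary.Unique.Propositional using (Unique)
open import Data.Fin.Base using ()
open import Data.List using (allFin)
open import Data.Sum using (_⊎_; inj₁; inj₂)
open import Data.Product using (_×_; Σ)
open import Data.Empty using (⊥)
open import Relation.Binary.PropositionalEquality using (_≡_; _≢_)
open import Relation.Nullary using (¬_)

record Graph : Set₁ where
  field
    n   : ℕ
    Adj : Fin n → Fin n → Set
open Graph public

Star : ℕ → Graph
Star m = record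
  { n   = suc m
  ; Adj = λ i j → (i ≡ zero × j ≢ zero) ⊎ (j ≡ zero × i ≢ zero)
  }

SumAdj : ∀ {a b} → (Fin a → Fin a → Set) → (Fin b → Fin b → Set)
       → Fin a ⊎ Fin b → Fin a ⊎ Fin b → Set
SumAdj A B (inj₁ x) (inj₁ y) = A x y
SumAdj A B (inj₂ x) (inj₂ y) = B x y
SumAdj A B (inj₁ _) (inj₂ _) = ⊥
SumAdj A B (inj₂ _) (inj₁ _) = ⊥

-- Disjoint union G + H (vertices of G first, then those of H).
_⊕_ : Graph → Graph → Graph
G ⊕ H = record
  { n   = n G + n H
  ; Adj = λ i j → SumAdj (Adj G) (Adj H) (splitAt (n G) i) (splitAt (n G) j)
  }

record Assignment (G : Graph) (k : ℕ) : Set where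
  field
    list     : Fin (n G) → Vec ℕ k
    distinct : ∀ v → Unique (list v)
open Assignment public

colourCount : ∀ {m} → (Fin m → ℕ) → ℕ → ℕ
colourCount {m} f c = length (filter (λ v → f v ≟ c) (allFin m))

⌈_/_⌉ : (a k : ℕ) → .{{NonZero k}} → ℕ
⌈ a / k ⌉ = (a + (k ∸ 1)) / k

record EquitableColouring (G : Graph) (k : ℕ) .{{_ : NonZero k}}
                          (L : Assignment G k) (f : Fin (n G) → ℕ) : Set where
  field
    fromList  : ∀ v → f v ∈ list L v
    proper    : ∀ u v → Adj G u v → f u ≢ f v
    equitable : ∀ c v → c ∈ list L v → colourCount f c ≤ ⌈ n G / k ⌉

EquitablyChoosable : (G : Graph) (k : ℕ) .{{_ : NonZero k}} → Set
EquitablyChoosable G k =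
  (L : Assignment G k) → Σ (Fin (n G) → ℕ) (λ f → EquitableColouring G k L f)

module Submission where

-- Give every vertex of G = K_{1,m₁} + K_{1,m₂} the same list
-- {1, 2}.  A proper colouring from these lists 2-colours each star: all m₂
-- leaves of the second star receive the colour c opposite to its centre, and
-- the edge centre–leaf of the first star (m₁ ≥ 1) also uses c.  Hence c is
-- used at least m₂ + 1 times, while equitability allows only
-- ⌈(m₁ + m₂ + 2)/2⌉ uses, which is smaller than m₂ + 1 exactly when
-- m₂ ≥ m₁ + 2.

open import Defs
open import Data.Nat using (ℕ; _≤_; _∸_)
open import Relation.Nullary using (¬_)

open import Data.Nat using (zero; suc; _+_; _*_; _<_; s≤s; z≤n)
open import Data.Nat.Properties
  using (_≟_; ≤-reflexive; ≤-trans; <⇒≱; m≤n+m; +-mono-≤; +-monoˡ-≤; +-monoʳ-≤; m+[n∸m]≡n; module ≤-Reasoning)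
open import Data.Nat.DivMod using (m<n*o⇒m/o<n)
open import Data.Nat.Tactic.RingSolver using (solve-∀)
open import Data.Fin using (Fin; _↑ˡ_; _↑ʳ_) renaming (zero to fzero; suc to fsuc)
open import Data.Fin.Properties using (splitAt-↑ˡ; splitAt-↑ʳ)
open import Data.List using (List; []; _∷_; _++_; length; filter; tabulate)
open import Data.List.Properties using (length-++; filter-++; filter-all; length-tabulate)
open import Data.List.Membership.Propositional as List using ()
open import Data.List.Membership.Propositional.Properties using (∈-filter⁺; ∈-tabulate⁺)
open import Data.List.Relation.Unary.All.Properties using (tabulate⁺)
open import Data.List.Relation.Unary.Any as ListAny using ()
open import Data.Vec using (Vec; _∷_; [])
open import Data.Vec.Membership.Propositional using (_∈_)
open import Data.Vec.Relation.Unary.Any using (here; there)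
open import Data.Vec.Relation.Unary.AllPairs using ([]; _∷_)
open import Data.Vec.Relation.Unary.All using ([]; _∷_)
open import Data.Sum using (_⊎_; inj₁; inj₂)
open import Data.Product using (∃; _×_; _,_)
open import Data.Empty using (⊥-elim)
open import Function using (_∘_; id)
open import Relation.Binary.PropositionalEquality
  using (_≡_; _≢_; refl; sym; cong; subst; subst₂; module ≡-Reasoning)

countOn : ∀ {N m} → (Fin N → ℕ) → ℕ → (Fin m → Fin N) → ℕ
countOn f c g = length (filter (λ v → f v ≟ c) (tabulate g))

tabulate-↑ : ∀ {A : Set} a b (g : Fin (a + b) → A) →
             tabulate g ≡ tabulate (g ∘ (_↑ˡ b)) ++ tabulate (g ∘ (a ↑ʳ_))
tabulate-↑ zero    b g = refl
tabulate-↑ (suc a) b g = cong (g fzero ∷_) (tabulate-↑ a b (g ∘ fsuc))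

countOn-↑ : ∀ {N} a b (f : Fin N → ℕ) c (g : Fin (a + b) → Fin N) →
            countOn f c g ≡ countOn f c (g ∘ (_↑ˡ b)) + countOn f c (g ∘ (a ↑ʳ_))
countOn-↑ a b f c g = begin
  length (filter P? (tabulate g))
    ≡⟨ cong (length ∘ filter P?) (tabulate-↑ a b g) ⟩
  length (filter P? (tabulate (g ∘ (_↑ˡ b)) ++ tabulate (g ∘ (a ↑ʳ_))))
    ≡⟨ cong length (filter-++ P? (tabulate (g ∘ (_↑ˡ b))) _) ⟩
  length (filter P? (tabulate (g ∘ (_↑ˡ b))) ++ filter P? (tabulate (g ∘ (a ↑ʳ_))))
    ≡⟨ length-++ (filter P? (tabulate (g ∘ (_↑ˡ b)))) ⟩
  countOn f c (g ∘ (_↑ˡ b)) + countOn f c (g ∘ (a ↑ʳ_)) ∎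
  where
  open ≡-Reasoning
  P? = λ v → f v ≟ c

countOn-↑ʳ-≤ : ∀ {N} a b (f : Fin N → ℕ) c (g : Fin (a + b) → Fin N) →
               countOn f c (g ∘ (a ↑ʳ_)) ≤ countOn f c g
countOn-↑ʳ-≤ a b f c g =
  subst (countOn f c (g ∘ (a ↑ʳ_)) ≤_) (sym (countOn-↑ a b f c g)) (m≤n+m _ _)

countOn-all : ∀ {N m} (f : Fin N → ℕ) c (g : Fin m → Fin N) →
              (∀ i → f (g i) ≡ c) → countOn f c g ≡ m
countOn-all f c g all-c = begin
  length (filter (λ v → f v ≟ c) (tabulate g)) ≡⟨ cong length (filter-all _ (tabulate⁺ all-c)) ⟩
  length (tabulate g)                          ≡⟨ length-tabulate g ⟩
  _                                            ∎
  where open ≡-Reasoning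

∈⇒length-pos : ∀ {A : Set} {x : A} {xs : List A} → x List.∈ xs → 1 ≤ length xs
∈⇒length-pos (ListAny.here _)  = s≤s z≤n
∈⇒length-pos (ListAny.there _) = s≤s z≤n

countOn-hit : ∀ {N m} (f : Fin N → ℕ) c (g : Fin m → Fin N) i →
              f (g i) ≡ c → 1 ≤ countOn f c g
countOn-hit f c g i fgi≡c = ∈⇒length-pos (∈-filter⁺ (λ v → f v ≟ c) (∈-tabulate⁺ i) fgi≡c)

centre-leaf : ∀ m (j : Fin m) → Adj (Star m) fzero (fsuc j)
centre-leaf m j = inj₁ (refl , λ ())

↑ˡ-adj : ∀ G H {u v} → Adj G u v → Adj (G ⊕ H) (u ↑ˡ n H) (v ↑ˡ n H)
↑ˡ-adj G H {u} {v} = subst₂ (SumAdj (Adj G) (Adj H))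
  (sym (splitAt-↑ˡ (n G) u (n H))) (sym (splitAt-↑ˡ (n G) v (n H)))

↑ʳ-adj : ∀ G H {u v} → Adj H u v → Adj (G ⊕ H) (n G ↑ʳ u) (n G ↑ʳ v)
↑ʳ-adj G H {u} {v} = subst₂ (SumAdj (Adj G) (Adj H))
  (sym (splitAt-↑ʳ (n G) (n H) u)) (sym (splitAt-↑ʳ (n G) (n H) v))

palette : Vec ℕ 2
palette = 1 ∷ 2 ∷ []

constantAssignment : ∀ G → Assignment G 2
constantAssignment G = record
  { list = λ _ → palette ; distinct = λ _ → ((λ ()) ∷ []) ∷ ([] ∷ []) }

other-colour : ∀ {x} → x ∈ palette → ∃ λ c → c ∈ palette × c ≢ x
other-colour (here refl)         = 2 , there (here refl) , λ ()
other-colour (there (here refl)) = 1 , here refl , λ ()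

distinct-covers : ∀ {x y c} → x ∈ palette → y ∈ palette → x ≢ y → c ∈ palette →
                  x ≡ c ⊎ y ≡ c
distinct-covers (here refl)         (here refl)         x≢y _ = ⊥-elim (x≢y refl)
distinct-covers (there (here refl)) (there (here refl)) x≢y _ = ⊥-elim (x≢y refl)
distinct-covers (here refl)         (there (here refl)) _ (here refl)         = inj₁ refl
distinct-covers (here refl)         (there (here refl)) _ (there (here refl)) = inj₂ refl
distinct-covers (there (here refl)) (here refl)         _ (here refl)         = inj₂ refl
distinct-covers (there (here refl)) (here refl)         _ (there (here refl)) = inj₁ refl

-- In a proper colouring of K_{1,k+1} + K_{1,m} from
-- {1, 2}, the colour c opposite to the second centre covers every leaf of
-- the second star and one end of an edge of the first star.
heavy-colour : ∀ k m (f : Fin (suc (suc k) + suc m) → ℕ) →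
               (∀ v → f v ∈ palette) →
               (∀ u v → Adj (Star (suc k) ⊕ Star m) u v → f u ≢ f v) →
               ∃ λ c → c ∈ palette × suc m ≤ colourCount f c
heavy-colour k m f inPalette proper with other-colour (inPalette (suc (suc k) ↑ʳ fzero))
... | c , c∈ , c≢ = c , c∈ , count-≥
  where
  G₁ G₂ : Graph
  G₁ = Star (suc k)
  G₂ = Star m
  a : ℕ
  a = suc (suc k)

  first : Fin a → Fin (a + suc m)
  first i = i ↑ˡ suc m
  second : Fin (suc m) → Fin (a + suc m)
  second j = a ↑ʳ j

  -- Each leaf of the second star is coloured c, since its centre is not.
  leaf₂-c : ∀ j → f (second (fsuc j)) ≡ c
  leaf₂-c j with distinct-covers (inPalette (second fzero)) (inPalette (second (fsuc j)))
                   (proper _ _ (↑ʳ-adj G₁ G₂ (centre-leaf m j))) c∈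
  ... | inj₁ centre≡c = ⊥-elim (c≢ (sym centre≡c))
  ... | inj₂ leaf≡c   = leaf≡c

  first-star : 1 ≤ countOn f c first
  first-star with distinct-covers (inPalette (first fzero)) (inPalette (first (fsuc fzero)))
                    (proper _ _ (↑ˡ-adj G₁ G₂ (centre-leaf (suc k) fzero))) c∈
  ... | inj₁ centre≡c = countOn-hit f c first fzero centre≡c
  ... | inj₂ leaf≡c   = countOn-hit f c first (fsuc fzero) leaf≡c

  second-star : m ≤ countOn f c second
  second-star = subst (_≤ countOn f c second) (countOn-all f c _ leaf₂-c)
                      (countOn-↑ʳ-≤ 1 m f c second)

  count-≥ : suc m ≤ colourCount f c
  count-≥ = subst (suc m ≤_) (sym (countOn-↑ a (suc m) f c id))
                  (+-mono-≤ first-star second-star)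

⌈half⌉< : ∀ m₁ m₂ → m₁ + 2 ≤ m₂ → ⌈ suc m₁ + suc m₂ / 2 ⌉ < suc m₂
⌈half⌉< m₁ m₂ gap = m<n*o⇒m/o<n (begin-strict
  suc m₁ + suc m₂ + 1  <⟨ ≤-reflexive (regroup m₁ m₂) ⟩
  (m₁ + 2) + (m₂ + 2)  ≤⟨ +-monoˡ-≤ (m₂ + 2) gap ⟩
  m₂ + (m₂ + 2)        ≡⟨ double m₂ ⟩
  suc m₂ * 2           ∎)
  where
  open ≤-Reasoning
  regroup : ∀ x y → suc (suc x + suc y + 1) ≡ (x + 2) + (y + 2)
  regroup = solve-∀
  double : ∀ y → y + (y + 2) ≡ suc y * 2
  double = solve-∀

corollary3p3 : (m₁ m₂ : ℕ) → 1 ≤ m₁ → m₁ ≤ m₂ → 2 ≤ m₂ ∸ m₁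
    → ¬ EquitablyChoosable (Star m₁ ⊕ Star m₂) 2
corollary3p3 (suc k) m₂ (s≤s z≤n) m₁≤m₂ 2≤gap choosable =
  let f , colouring  = choosable (constantAssignment _)
      open EquitableColouring colouring
      c , c∈ , heavy = heavy-colour k m₂ f fromList proper
  in <⇒≱ (⌈half⌉< (suc k) m₂ gap) (≤-trans heavy (equitable c fzero c∈))
  where
  gap : suc k + 2 ≤ m₂
  gap = subst (suc k + 2 ≤_) (m+[n∸m]≡n m₁≤m₂) (+-monoʳ-≤ (suc k) 2≤gap)
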